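{- Let $m$ be a positive integer with $2\,\|\, m$ (i.e. $2\mid m$ but $4\nmid m$). Let $A, B\subseteq \mathbb{Z}_{m}$ satisfy $A\cup B=\mathbb{Z}_{m}$ and $|A\cap B|=4$ or $|A\cap B|=m-4$. Then $R_{A}(\overline{n})=R_{B}(\overline{n})$ for all $\overline{n}\in \mathbb{Z}_{m}$ if and only if $B=A+\overline{\frac{m}{2}}$.
   Context: $\mathbb{Z}_m$ denotes the set (group) of residue classes modulo $m$. For $A\subseteq\mathbb{Z}_m$ and $\overline{n}\in\mathbb{Z}_m$, $R_A(\overline{n})$ is the number of ordered pairs $(\overline{a},\overline{a'})\in A\times A$ with $\overline{a}+\overline{a'}=\overline{n}$. For $\overline{c}\in\mathbb{Z}_m$, $A+\overline{c}=\{\overline{a}+\overline{c}:\overline{a}\in A\}$. -}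

module Defs where

open import Data.Nat using (ℕ; _+_; _∸_; NonZero)
open import Data.Nat.DivMod using (_mod_)
open import Data.Fin using (Fin; toℕ)
open import Data.Fin.Subset using (Subset; inside; outside)
open import Data.Vec using (lookup; tabulate)
open import Data.List using (List; length; filter)
open import Data.List using (allFin; cartesianProduct)
open import Data.Product using (_×_; _,_)
open import Data.Bool using (Bool; true; false; _∧_; T)
open import Relation.Nullary using (Dec; yes; no)
open import Relation.Nullary.Decidable using (⌊_⌋)
open import Data.Fin.Properties using (_≟_)

-- ℤ_m is modelled by Fin m, with addition modulo m.
_+ₘ_ : {m : ℕ} .{{_ : NonZero m}} → Fin m → Fin m → Fin m
_+ₘ_ {m} a b = (toℕ a + toℕ b) mod m

_-ₘ_ : {m : ℕ} .{{_ : NonZero m}} → Fin m → Fin m → Fin m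
_-ₘ_ {m} a b = (toℕ a + (m ∸ toℕ b)) mod m

[_]ₘ : {m : ℕ} .{{_ : NonZero m}} → ℕ → Fin m
[_]ₘ {m} k = k mod m

mem : {m : ℕ} → Fin m → Subset m → Bool
mem x A with lookup A x
... | inside = true
... | outside = false

-- A + c = { a + c : a ∈ A };  x ∈ A + c  iff  x - c ∈ A
_⊕_ : {m : ℕ} .{{_ : NonZero m}} → Subset m → Fin m → Subset m
A ⊕ c = tabulate (λ x → lookup A (x -ₘ c))

R : {m : ℕ} .{{_ : NonZero m}} → Subset m → Fin m → ℕ
R {m} A n = length (filter (λ p → test p) (cartesianProduct (allFin m) (allFin m)))
  where
  test : (p : Fin m × Fin m) → Dec (T (mem (Data.Product.proj₁ p) A ∧ mem (Data.Product.proj₂ p) A ∧ ⌊ (Data.Product.proj₁ p +ₘ Data.Product.proj₂ p) ≟ n ⌋))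
  test p = Data.Bool.T? _

module Submission where

-- Let a, b, c be the indicators of A, B and A ∩ B, and D = a − b; since A ∪ B = ℤ_m, a + b = 1 + c.
-- With (f ∗ g)(z) = Σₓ f(x) g(z − x) we have R_A = a ∗ a, so R_A = R_B says D ∗ (a + b) = D ∗ (1 + c) = 0.
-- Summing over z gives ΣD · Σ(1 + c) = 0, hence ΣD = 0 and D ∗ c = D ∗ (1 − c) = 0.
-- Let s = c if |A ∩ B| = 4 and s = 1 − c if |A ∩ B| = m − 4, so that Σs ∈ {2, 4}.  As D = (1 + c) − 2b
-- = 2(1 − b) − (1 − c), the relation D ∗ s = 0 shows that s ∗ s is even.  Put t = m/2; the solutions of
-- 2x = 2y are x = y and x = y + t, so (s ∗ s)(2y) ≡ s(y) + s(y + t) (mod 2): s is t-periodic, i.e. the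
-- indicator of one or two cosets {a, a + t}.  Convolving D with {a, a + t} gives u(z − a), where
-- u(x) = D(x) + D(x + t).  For two cosets this says u(x) = −u(x + a − b); as t is odd, t·(a − b) ∈ {0, t},
-- so u(x) = −u(x) and u = 0.  Finally D(x) + D(x + t) = 0 together with a + b ≥ 1 forces B = A + t.
-- The converse is a change of variables.

open import Defs
open import Data.Nat using (ℕ; NonZero; _∸_; _/_)
open import Data.Nat.Divisibility using (_∣_)
open import Data.Fin.Subset using (Subset; _∪_; _∩_; ⊤; ∣_∣)
open import Data.Product using (_×_)
open import Data.Sum using (_⊎_)
open import Relation.Nullary using (¬_)
open import Relation.Binary.PropositionalEquality using (_≡_)
open import Function.Bundles using (_⇔_)

open import Level using (0ℓ)
open import Algebra.Bundles using (AbelianGroup)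
open import Algebra.Structures using (IsAbelianGroup)
open import Data.Bool using (Bool; true; false; _∧_; _∨_; not)
open import Data.Empty using (⊥-elim)
open import Data.Fin as Fin using (Fin)
import Data.Fin.Properties as Fin
import Data.Fin.Permutation as Perm
open import Data.Fin.Subset using (∁)
open import Data.Fin.Subset.Properties using (∣∁p∣≡n∸∣p∣)
open import Data.Integer as ℤ using (ℤ; -_; _+_; _*_; _-_; 0ℤ; 1ℤ)
import Data.Integer.Properties as ℤ
open import Data.Integer.Tactic.RingSolver using (solve-∀)
open import Data.List as List using (length; filter; cartesianProduct; _++_)
import Data.List.Properties as List
open import Data.Nat as ℕ using (zero; suc; _%_)
import Data.Nat.Properties as ℕ
open import Data.Nat.DivMod using (m≡m%n+[m/n]*n; m%n<n; m*n/n≡m)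
open import Data.Nat.Divisibility using (divides)
open import Data.Nat.Tactic.RingSolver using () renaming (solve-∀ to ℕ-solve-∀)
open import Data.Product using (∃; _,_; proj₁; proj₂)
open import Data.Sum as Sum using (inj₁; inj₂)
open import Data.Vec using (lookup; []; _∷_)
import Data.Vec.Properties as Vec
open import Function using (_∘_; id)
open import Function.Bundles using (mk⇔; Equivalence)
open import Relation.Binary.Definitions using (tri<; tri≈; tri>)
open import Relation.Binary.PropositionalEquality
  using (refl; sym; trans; cong; cong₂; subst; module ≡-Reasoning)
open import Relation.Nullary using (Dec; yes; no; does; _because_; contradiction)
open import Relation.Nullary.Decidable using (⌊_⌋; dec-true; dec-false; _⊎-dec_)

import Algebra.Properties.AbelianGroup ℤ.+-0-abelianGroup as ℤ-Group
open import Algebra.Properties.Ring ℤ.+-*-ring using (x[y-z]≈xy-xz; [y-z]x≈yx-zx)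
open import Algebra.Properties.Semiring.Sum ℤ.+-*-semiring
  using (sum; ∑-comm; ∑-distrib-+; sum-permute; sum-cong-≗; sum-replicate-zero; *-distribˡ-sum; *-distribʳ-sum)

∑-neg : ∀ {n} (f : Fin n → ℤ) → sum (λ x → - f x) ≡ - sum f
∑-neg {zero}  f = refl
∑-neg {suc n} f = trans (cong ((- f Fin.zero) +_) (∑-neg (f ∘ Fin.suc))) (sym (ℤ.neg-distrib-+ (f Fin.zero) _))

∑-distrib-- : ∀ {n} (f g : Fin n → ℤ) → sum (λ x → f x - g x) ≡ sum f - sum g
∑-distrib-- f g = trans (∑-distrib-+ f (-_ ∘ g)) (cong (sum f +_) (∑-neg g))

sum-reindex : ∀ {n} (σ τ : Fin n → Fin n) → (∀ x → σ (τ x) ≡ x) → (∀ x → τ (σ x) ≡ x) →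
              (f : Fin n → ℤ) → sum f ≡ sum (f ∘ σ)
sum-reindex σ τ στ τσ f = sum-permute f (Perm.permutation σ τ στ τσ)

sum-nonneg : ∀ {n} {f : Fin n → ℤ} → (∀ x → 0ℤ ℤ.≤ f x) → 0ℤ ℤ.≤ sum f
sum-nonneg {zero}  _   = ℤ.≤-refl
sum-nonneg {suc n} 0≤f = ℤ.+-mono-≤ (0≤f Fin.zero) (sum-nonneg (0≤f ∘ Fin.suc))

nonneg-+≡0 : ∀ {i j} → 0ℤ ℤ.≤ i → 0ℤ ℤ.≤ j → i + j ≡ 0ℤ → i ≡ 0ℤ × j ≡ 0ℤ
nonneg-+≡0 {ℤ.+ a} {ℤ.+ b} _ _ a+b≡0 =
  cong ℤ.+_ (ℕ.m+n≡0⇒m≡0 a (ℤ.+-injective a+b≡0)) , cong ℤ.+_ (ℕ.m+n≡0⇒n≡0 a (ℤ.+-injective a+b≡0))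

nonneg-sum≡0⇒≡0 : ∀ {n} {f : Fin n → ℤ} → (∀ x → 0ℤ ℤ.≤ f x) → sum f ≡ 0ℤ → ∀ x → f x ≡ 0ℤ
nonneg-sum≡0⇒≡0 {suc n} 0≤f Σf≡0 Fin.zero =
  proj₁ (nonneg-+≡0 (0≤f Fin.zero) (sum-nonneg (0≤f ∘ Fin.suc)) Σf≡0)
nonneg-sum≡0⇒≡0 {suc n} 0≤f Σf≡0 (Fin.suc x) =
  nonneg-sum≡0⇒≡0 (0≤f ∘ Fin.suc) (proj₂ (nonneg-+≡0 (0≤f Fin.zero) (sum-nonneg (0≤f ∘ Fin.suc)) Σf≡0)) x

sum≢0⇒∃≢0 : ∀ {n} {f : Fin n → ℤ} → ¬ sum f ≡ 0ℤ → ∃ λ x → ¬ f x ≡ 0ℤ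
sum≢0⇒∃≢0 {zero}      Σf≢0 = ⊥-elim (Σf≢0 refl)
sum≢0⇒∃≢0 {suc n} {f} Σf≢0 with f Fin.zero ℤ.≟ 0ℤ
... | no f₀≢0  = Fin.zero , f₀≢0
... | yes f₀≡0 =
  let x , fx≢0 = sum≢0⇒∃≢0 {f = f ∘ Fin.suc} (λ Σtail≡0 → Σf≢0 (cong₂ _+_ f₀≡0 Σtail≡0)) in Fin.suc x , fx≢0

toℤ : Bool → ℤ
toℤ true  = 1ℤ
toℤ false = 0ℤ

toℤ-∧ : ∀ p q → toℤ (p ∧ q) ≡ toℤ p * toℤ q
toℤ-∧ true  q = sym (ℤ.*-identityˡ (toℤ q))
toℤ-∧ false q = refl

toℤ-isYes : ∀ {P : Set} (P? : Dec P) → toℤ ⌊ P? ⌋ ≡ toℤ (does P?)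
toℤ-isYes (true  because _) = refl
toℤ-isYes (false because _) = refl

Binary : ∀ {n} → (Fin n → ℤ) → Set
Binary f = ∀ x → f x ≡ 0ℤ ⊎ f x ≡ 1ℤ

binary-nonneg : ∀ {n} {f : Fin n → ℤ} → Binary f → ∀ x → 0ℤ ℤ.≤ f x
binary-nonneg bf x with bf x
... | inj₁ fx≡0 = ℤ.≤-reflexive (sym fx≡0)
... | inj₂ fx≡1 = ℤ.≤-trans (ℤ.+≤+ ℕ.z≤n) (ℤ.≤-reflexive (sym fx≡1))

binary-sum≢0⇒∃≡1 : ∀ {n} {f : Fin n → ℤ} → Binary f → ¬ sum f ≡ 0ℤ → ∃ λ x → f x ≡ 1ℤ
binary-sum≢0⇒∃≡1 bf Σf≢0 with sum≢0⇒∃≢0 Σf≢0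
... | x , fx≢0 with bf x
...   | inj₁ fx≡0 = ⊥-elim (fx≢0 fx≡0)
...   | inj₂ fx≡1 = x , fx≡1

binary-square : ∀ {p} → p ≡ 0ℤ ⊎ p ≡ 1ℤ → p * p ≡ p
binary-square (inj₁ refl) = refl
binary-square (inj₂ refl) = refl

1≢2* : ∀ k → ¬ 1ℤ ≡ ℤ.+ 2 * k
1≢2* k 1≡2k with ℕ.m*n≡1⇒m≡1 2 ℤ.∣ k ∣ (sym (trans (cong ℤ.∣_∣ 1≡2k) (ℤ.abs-* (ℤ.+ 2) k)))
... | ()

binary-sum-even⇒≡ : ∀ {p q} → p ≡ 0ℤ ⊎ p ≡ 1ℤ → q ≡ 0ℤ ⊎ q ≡ 1ℤ → ∀ k → p + q ≡ ℤ.+ 2 * k → p ≡ q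
binary-sum-even⇒≡ (inj₁ refl) (inj₁ refl) k _    = refl
binary-sum-even⇒≡ (inj₂ refl) (inj₂ refl) k _    = refl
binary-sum-even⇒≡ (inj₁ refl) (inj₂ refl) k 1≡2k = ⊥-elim (1≢2* k 1≡2k)
binary-sum-even⇒≡ (inj₂ refl) (inj₁ refl) k 1≡2k = ⊥-elim (1≢2* k 1≡2k)

χ : ∀ {n} → Subset n → Fin n → ℤ
χ S x = toℤ (lookup S x)

χ-binary : ∀ {n} (S : Subset n) → Binary (χ S)
χ-binary S x with lookup S x
... | true  = inj₂ refl
... | false = inj₁ refl

sum-χ : ∀ {n} (S : Subset n) → sum (χ S) ≡ ℤ.+ ∣ S ∣
sum-χ []          = refl
sum-χ (true  ∷ S) = cong (1ℤ +_) (sum-χ S)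
sum-χ (false ∷ S) = trans (ℤ.+-identityˡ (sum (χ S))) (sum-χ S)

χ-∁ : ∀ {n} (S : Subset n) x → χ (∁ S) x ≡ 1ℤ - χ S x
χ-∁ S x rewrite Vec.lookup-map x not S with lookup S x
... | true  = refl
... | false = refl

∪≡⊤⇒covers : ∀ {n} {A B : Subset n} → A ∪ B ≡ ⊤ → ∀ x → lookup A x ∨ lookup B x ≡ true
∪≡⊤⇒covers {A = A} {B} A∪B≡⊤ x =
  trans (sym (Vec.lookup-zipWith _∨_ x A B)) (trans (cong (λ S → lookup S x) A∪B≡⊤) (Vec.lookup-replicate x true))

χ-∪-∩ : ∀ {n} {A B : Subset n} → A ∪ B ≡ ⊤ → ∀ x → χ A x + χ B x ≡ 1ℤ + χ (A ∩ B) x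
χ-∪-∩ {A = A} {B} A∪B≡⊤ x rewrite Vec.lookup-zipWith _∧_ x A B =
  covered (lookup A x) (lookup B x) (∪≡⊤⇒covers A∪B≡⊤ x)
  where
  covered : ∀ p q → p ∨ q ≡ true → toℤ p + toℤ q ≡ 1ℤ + toℤ (p ∧ q)
  covered true  true  _ = refl
  covered true  false _ = refl
  covered false true  _ = refl

mem≡lookup : ∀ {n} (x : Fin n) (S : Subset n) → mem x S ≡ lookup S x
mem≡lookup x S with lookup S x
... | true  = refl
... | false = refl

-- Written with does rather than ⌊_⌋, so that δ (suc c) (suc x) reduces to δ c x.
δ : ∀ {n} → Fin n → Fin n → ℤ
δ c x = toℤ (does (x Fin.≟ c))

δ-refl : ∀ {n} {c x : Fin n} → x ≡ c → δ c x ≡ 1ℤ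
δ-refl {c = c} {x} x≡c = cong toℤ (dec-true (x Fin.≟ c) x≡c)

δ-≢ : ∀ {n} {c x : Fin n} → ¬ x ≡ c → δ c x ≡ 0ℤ
δ-≢ {c = c} {x} x≢c = cong toℤ (dec-false (x Fin.≟ c) x≢c)

δ-inverse : ∀ {n} {σ τ : Fin n → Fin n} → (∀ x → τ (σ x) ≡ x) → (∀ x → σ (τ x) ≡ x) →
            ∀ c x → δ c (σ x) ≡ δ (τ c) x
δ-inverse {σ = σ} {τ} τσ στ c x with σ x Fin.≟ c | x Fin.≟ τ c
... | yes _    | yes _    = refl
... | no  _    | no  _    = refl
... | yes σx≡c | no  x≢τc = ⊥-elim (x≢τc (trans (sym (τσ x)) (cong τ σx≡c)))
... | no  σx≢c | yes x≡τc = ⊥-elim (σx≢c (trans (cong σ x≡τc) (στ c)))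

∑-δ : ∀ {n} (c : Fin n) (g : Fin n → ℤ) → sum (λ x → δ c x * g x) ≡ g c
∑-δ {suc n} Fin.zero g = begin
  1ℤ * g Fin.zero + sum (λ x → 0ℤ * g (Fin.suc x))  ≡⟨ cong₂ _+_ (ℤ.*-identityˡ (g Fin.zero)) (sum-cong-≗ (λ x → ℤ.*-zeroˡ (g (Fin.suc x)))) ⟩
  g Fin.zero + sum {n} (λ _ → 0ℤ)                   ≡⟨ cong (g Fin.zero +_) (sum-replicate-zero n) ⟩
  g Fin.zero + 0ℤ                                   ≡⟨ ℤ.+-identityʳ (g Fin.zero) ⟩
  g Fin.zero                                        ∎
  where open ≡-Reasoning
∑-δ {suc n} (Fin.suc c) g =
  trans (cong (_+ sum (λ x → δ c x * g (Fin.suc x))) (ℤ.*-zeroˡ (g Fin.zero)))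
        (trans (ℤ.+-identityˡ _) (∑-δ c (g ∘ Fin.suc)))

sum-δ : ∀ {n} (c : Fin n) → sum (δ c) ≡ 1ℤ
sum-δ c = trans (sum-cong-≗ (λ x → sym (ℤ.*-identityʳ (δ c x)))) (∑-δ c (λ _ → 1ℤ))

lt : ∀ {n} → Fin n → Fin n → ℤ
lt x y = toℤ (does (x Fin.<? y))

lt+gt+eq : ∀ {n} (x y : Fin n) → lt x y + lt y x + δ y x ≡ 1ℤ
lt+gt+eq x y with Fin.<-cmp x y
... | tri< x<y x≢y y≮x
  rewrite dec-true (x Fin.<? y) x<y | dec-false (y Fin.<? x) y≮x | dec-false (x Fin.≟ y) x≢y = refl
... | tri≈ x≮y x≡y y≮x
  rewrite dec-false (x Fin.<? y) x≮y | dec-false (y Fin.<? x) y≮x | dec-true (x Fin.≟ y) x≡y = refl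
... | tri> x≮y x≢y y<x
  rewrite dec-false (x Fin.<? y) x≮y | dec-true (y Fin.<? x) y<x | dec-false (x Fin.≟ y) x≢y = refl

-- An involution pairs off the points it moves; only its fixed points can contribute an odd amount.
sum-involution : ∀ {n} (σ : Fin n → Fin n) → (∀ x → σ (σ x) ≡ x) → (F : Fin n → ℤ) → (∀ x → F (σ x) ≡ F x) →
  sum F ≡ ℤ.+ 2 * sum (λ x → F x * lt x (σ x)) + sum (λ x → F x * δ (σ x) x)
sum-involution σ σσ F Fσ = begin
  sum F                                                    ≡⟨ sum-cong-≗ split ⟩
  sum (λ x → F x * lt x (σ x) + F x * lt (σ x) x + E x)    ≡⟨ ∑-distrib-+ (λ x → F x * lt x (σ x) + F x * lt (σ x) x) E ⟩
  sum (λ x → F x * lt x (σ x) + F x * lt (σ x) x) + ΣE     ≡⟨ cong (_+ ΣE) (∑-distrib-+ (λ x → F x * lt x (σ x)) (λ x → F x * lt (σ x) x)) ⟩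
  L + sum (λ x → F x * lt (σ x) x) + ΣE                    ≡⟨ cong (λ w → L + w + ΣE) swap ⟩
  L + L + ΣE                                               ≡⟨ cong (_+ ΣE) (trans (ℤ.*-distribʳ-+ L 1ℤ 1ℤ) (cong₂ _+_ (ℤ.*-identityˡ L) (ℤ.*-identityˡ L))) ⟨
  ℤ.+ 2 * L + ΣE                                           ∎
  where
  open ≡-Reasoning
  E = λ x → F x * δ (σ x) x
  ΣE = sum E
  L = sum (λ x → F x * lt x (σ x))
  split : ∀ x → F x ≡ F x * lt x (σ x) + F x * lt (σ x) x + E x
  split x = begin
    F x                                            ≡⟨ ℤ.*-identityʳ (F x) ⟨
    F x * 1ℤ                                       ≡⟨ cong (F x *_) (lt+gt+eq x (σ x)) ⟨
    F x * (lt x (σ x) + lt (σ x) x + δ (σ x) x)    ≡⟨ ℤ.*-distribˡ-+ (F x) _ (δ (σ x) x) ⟩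
    F x * (lt x (σ x) + lt (σ x) x) + E x          ≡⟨ cong (_+ E x) (ℤ.*-distribˡ-+ (F x) (lt x (σ x)) (lt (σ x) x)) ⟩
    F x * lt x (σ x) + F x * lt (σ x) x + E x      ∎
  swap : sum (λ x → F x * lt (σ x) x) ≡ L
  swap = trans (sum-reindex σ σ σσ σσ (λ x → F x * lt (σ x) x))
               (sum-cong-≗ (λ x → cong₂ (λ p q → p * lt q (σ x)) (Fσ x) (σσ x)))

module _ {A : Set} {P : A → Set} (P? : ∀ x → Dec (P x)) where

  count-tabulate : ∀ {k} (f : Fin k → A) →
                   ℤ.+ length (filter P? (List.tabulate f)) ≡ sum (λ i → toℤ (does (P? (f i))))
  count-tabulate {zero}  f = refl
  count-tabulate {suc k} f with does (P? (f Fin.zero))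
  ... | true  = cong (1ℤ +_) (count-tabulate (f ∘ Fin.suc))
  ... | false = trans (count-tabulate (f ∘ Fin.suc)) (sym (ℤ.+-identityˡ _))

module _ {B C : Set} {P : B × C → Set} (P? : ∀ x → Dec (P x)) where

  count-cartesianProduct : ∀ {k l} (f : Fin k → B) (g : Fin l → C) →
    ℤ.+ length (filter P? (cartesianProduct (List.tabulate f) (List.tabulate g))) ≡
    sum (λ i → sum (λ j → toℤ (does (P? (f i , g j)))))
  count-cartesianProduct {zero}  f g = refl
  count-cartesianProduct {suc k} f g = begin
    ℤ.+ length (filter P? (row ++ rest))                        ≡⟨ cong (ℤ.+_ ∘ length) (List.filter-++ P? row rest) ⟩
    ℤ.+ length (filter P? row ++ filter P? rest)                ≡⟨ cong ℤ.+_ (List.length-++ (filter P? row)) ⟩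
    ℤ.+ (length (filter P? row) ℕ.+ length (filter P? rest))    ≡⟨ ℤ.pos-+ (length (filter P? row)) _ ⟩
    ℤ.+ length (filter P? row) + ℤ.+ length (filter P? rest)    ≡⟨ cong₂ _+_ count-row (count-cartesianProduct (f ∘ Fin.suc) g) ⟩
    sum (λ j → toℤ (does (P? (f Fin.zero , g j)))) + _          ∎
    where
    open ≡-Reasoning
    row = List.map (f Fin.zero ,_) (List.tabulate g)
    rest = cartesianProduct (List.tabulate (f ∘ Fin.suc)) (List.tabulate g)
    count-row : ℤ.+ length (filter P? row) ≡ sum (λ j → toℤ (does (P? (f Fin.zero , g j))))
    count-row = trans (cong (ℤ.+_ ∘ length ∘ filter P?) (List.map-tabulate g (f Fin.zero ,_)))
                      (count-tabulate P? (λ j → f Fin.zero , g j))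

-- Arithmetic of twice an odd number

double-injective : ∀ {a b} → a ℕ.+ a ≡ b ℕ.+ b → a ≡ b
double-injective {a} {b} a+a≡b+b = ℕ.*-cancelˡ-≡ a b 2
  (trans (cong (a ℕ.+_) (ℕ.+-identityʳ a)) (trans a+a≡b+b (sym (cong (b ℕ.+_) (ℕ.+-identityʳ b)))))

double-divisible : ∀ {a h} → a ℕ.< h ℕ.+ h → (h ℕ.+ h) ∣ (a ℕ.+ a) → a ≡ 0 ⊎ a ≡ h
double-divisible {a} {h} a<2h (divides zero a+a≡0) = inj₁ (ℕ.m+n≡0⇒m≡0 a a+a≡0)
double-divisible {a} {h} a<2h (divides 1 a+a≡2h) = inj₂ (double-injective (trans a+a≡2h (ℕ.+-identityʳ (h ℕ.+ h))))
double-divisible {a} {h} a<2h (divides (suc (suc r)) a+a≡q*2h) = ⊥-elim (ℕ.<-irrefl a+a≡q*2h (begin-strict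
  a ℕ.+ a                      <⟨ ℕ.+-mono-< a<2h a<2h ⟩
  (h ℕ.+ h) ℕ.+ (h ℕ.+ h)      ≤⟨ ℕ.+-monoʳ-≤ (h ℕ.+ h) (ℕ.m≤m+n (h ℕ.+ h) (r ℕ.* (h ℕ.+ h))) ⟩
  suc (suc r) ℕ.* (h ℕ.+ h)    ∎))
  where open ℕ.≤-Reasoning

twice-odd-of : ∀ {m} → 2 ∣ m → ¬ 4 ∣ m → ∃ λ j → m ≡ suc (j ℕ.+ j) ℕ.+ suc (j ℕ.+ j)
twice-odd-of {m} (divides q m≡q*2) 4∤m with q % 2 | m≡m%n+[m/n]*n q 2 | m%n<n q 2
... | 0 | q≡[q/2]*2 | _ = ⊥-elim (4∤m (divides (q / 2) (trans m≡q*2 (trans (cong (ℕ._* 2) q≡[q/2]*2) (even (q / 2))))))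
  where
  even : ∀ r → (0 ℕ.+ r ℕ.* 2) ℕ.* 2 ≡ r ℕ.* 4
  even = ℕ-solve-∀
... | 1 | q≡1+[q/2]*2 | _ = q / 2 , trans m≡q*2 (trans (cong (ℕ._* 2) q≡1+[q/2]*2) (odd (q / 2)))
  where
  odd : ∀ r → (1 ℕ.+ r ℕ.* 2) ℕ.* 2 ≡ suc (r ℕ.+ r) ℕ.+ suc (r ℕ.+ r)
  odd = ℕ-solve-∀
... | suc (suc _) | _ | ℕ.s≤s (ℕ.s≤s ())

half≡ : ∀ {m h} → m ≡ h ℕ.+ h → m / 2 ≡ h
half≡ {m} {h} m≡h+h = trans (cong (_/ 2) (trans m≡h+h (sym (h*2 h)))) (m*n/n≡m h 2)
  where
  h*2 : ∀ h → h ℕ.* 2 ≡ h ℕ.+ h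
  h*2 = ℕ-solve-∀

-- ℤ_m as an abelian group

module ZMod (m : ℕ) .{{_ : NonZero m}} where

  open import Data.Nat.DivMod using (%-distribˡ-+; m<n⇒m%n≡m; n%n≡0)

  𝟘ₘ : Fin m
  𝟘ₘ = [ 0 ]ₘ

  negₘ : Fin m → Fin m
  negₘ a = [ m ∸ Fin.toℕ a ]ₘ

  toℕ-[] : ∀ k → Fin.toℕ ([_]ₘ {m} k) ≡ k % m
  toℕ-[] k = Fin.toℕ-fromℕ< _

  toℕ-𝟘 : Fin.toℕ 𝟘ₘ ≡ 0
  toℕ-𝟘 = trans (toℕ-[] 0) (m<n⇒m%n≡m (ℕ.>-nonZero⁻¹ m))

  []-cong : ∀ {k l} → k % m ≡ l % m → [ k ]ₘ ≡ [ l ]ₘ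
  []-cong {k} {l} eq = Fin.toℕ-injective (trans (toℕ-[] k) (trans eq (sym (toℕ-[] l))))

  []-toℕ : ∀ a → [ Fin.toℕ a ]ₘ ≡ a
  []-toℕ a = Fin.toℕ-injective (trans (toℕ-[] (Fin.toℕ a)) (m<n⇒m%n≡m (Fin.toℕ<n a)))

  []-+ : ∀ k l → [ k ℕ.+ l ]ₘ ≡ [ k ]ₘ +ₘ [ l ]ₘ
  []-+ k l = []-cong (trans (%-distribˡ-+ k l m) (sym (cong₂ (λ x y → (x ℕ.+ y) % m) (toℕ-[] k) (toℕ-[] l))))

  []-≡𝟘 : ∀ {k} → k % m ≡ 0 → [ k ]ₘ ≡ 𝟘ₘ
  []-≡𝟘 k%m≡0 = Fin.toℕ-injective (trans (toℕ-[] _) (trans k%m≡0 (sym toℕ-𝟘)))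

  +ₘ-comm : ∀ a b → a +ₘ b ≡ b +ₘ a
  +ₘ-comm a b = cong [_]ₘ (ℕ.+-comm (Fin.toℕ a) (Fin.toℕ b))

  +ₘ-assoc : ∀ a b c → (a +ₘ b) +ₘ c ≡ a +ₘ (b +ₘ c)
  +ₘ-assoc a b c = begin
    (a +ₘ b) +ₘ c             ≡⟨ cong ((a +ₘ b) +ₘ_) ([]-toℕ c) ⟨
    (a +ₘ b) +ₘ [ tc ]ₘ       ≡⟨ []-+ (ta ℕ.+ tb) tc ⟨
    [ ta ℕ.+ tb ℕ.+ tc ]ₘ     ≡⟨ cong [_]ₘ (ℕ.+-assoc ta tb tc) ⟩
    [ ta ℕ.+ (tb ℕ.+ tc) ]ₘ   ≡⟨ []-+ ta (tb ℕ.+ tc) ⟩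
    [ ta ]ₘ +ₘ (b +ₘ c)       ≡⟨ cong (_+ₘ (b +ₘ c)) ([]-toℕ a) ⟩
    a +ₘ (b +ₘ c)             ∎
    where
    open ≡-Reasoning
    ta = Fin.toℕ a
    tb = Fin.toℕ b
    tc = Fin.toℕ c

  +ₘ-identityˡ : ∀ a → 𝟘ₘ +ₘ a ≡ a
  +ₘ-identityˡ a = trans (cong (𝟘ₘ +ₘ_) (sym ([]-toℕ a))) (trans (sym ([]-+ 0 (Fin.toℕ a))) ([]-toℕ a))

  +ₘ-inverseʳ : ∀ a → a +ₘ negₘ a ≡ 𝟘ₘ
  +ₘ-inverseʳ a = begin
    a +ₘ negₘ a                            ≡⟨ cong (_+ₘ negₘ a) ([]-toℕ a) ⟨
    [ ta ]ₘ +ₘ [ m ∸ ta ]ₘ                 ≡⟨ []-+ ta (m ∸ ta) ⟨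
    [ ta ℕ.+ (m ∸ ta) ]ₘ                   ≡⟨ cong [_]ₘ (ℕ.m+[n∸m]≡n (ℕ.<⇒≤ (Fin.toℕ<n a))) ⟩
    [ m ]ₘ                                 ≡⟨ []-≡𝟘 (n%n≡0 m) ⟩
    𝟘ₘ                                     ∎
    where
    open ≡-Reasoning
    ta = Fin.toℕ a

  +ₘ-isAbelianGroup : IsAbelianGroup _≡_ _+ₘ_ 𝟘ₘ negₘ
  +ₘ-isAbelianGroup = record
    { isGroup = record
      { isMonoid = record
        { isSemigroup = record
          { isMagma = record { isEquivalence = ≡.isEquivalence ; ∙-cong = cong₂ _+ₘ_ }
          ; assoc = +ₘ-assoc }
        ; identity = +ₘ-identityˡ , λ a → trans (+ₘ-comm a 𝟘ₘ) (+ₘ-identityˡ a) }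
      ; inverse = (λ a → trans (+ₘ-comm (negₘ a) a) (+ₘ-inverseʳ a)) , +ₘ-inverseʳ
      ; ⁻¹-cong = cong negₘ }
    ; comm = +ₘ-comm }
    where import Relation.Binary.PropositionalEquality as ≡

  -ₘ≡+ₘnegₘ : ∀ a b → a -ₘ b ≡ a +ₘ negₘ b
  -ₘ≡+ₘnegₘ a b = trans ([]-+ (Fin.toℕ a) (m ∸ Fin.toℕ b)) (cong (_+ₘ negₘ b) ([]-toℕ a))

-- Convolution on a finite abelian group

module Convolution {n : ℕ} {op : Fin n → Fin n → Fin n} {neutral : Fin n} {inv : Fin n → Fin n}
                   (isAbelianGroup : IsAbelianGroup _≡_ op neutral inv) where

  G : AbelianGroup 0ℓ 0ℓ
  G = record { isAbelianGroup = isAbelianGroup }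

  open AbelianGroup G public using (_∙_; ε; _⁻¹) renaming (_-_ to _//_)
  open AbelianGroup G using (assoc; comm; identityʳ; inverseʳ; rawMonoid; commutativeSemigroup)
  open import Algebra.Properties.AbelianGroup G
    using (xyx⁻¹≈y; ⁻¹-anti-homo-//; //-rightDividesˡ; //-rightDividesʳ; inverseʳ-unique; x∙y⁻¹≈ε⇒x≈y; ⁻¹-∙-comm; ∙-cancelˡ)
  open import Algebra.Properties.CommutativeSemigroup commutativeSemigroup using (interchange)
  open import Algebra.Definitions.RawMonoid rawMonoid public using () renaming (_×_ to _·_)

  reflect-involutive : ∀ z x → z // (z // x) ≡ x
  reflect-involutive z x = begin
    z ∙ (z // x) ⁻¹  ≡⟨ cong (z ∙_) (⁻¹-anti-homo-// z x) ⟩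
    z ∙ (x ∙ z ⁻¹)   ≡⟨ assoc z x (z ⁻¹) ⟨
    z ∙ x ∙ z ⁻¹     ≡⟨ xyx⁻¹≈y z x ⟩
    x                ∎
    where open ≡-Reasoning

  sum-reflect : ∀ z (f : Fin n → ℤ) → sum f ≡ sum (λ x → f (z // x))
  sum-reflect z = sum-reindex (z //_) (z //_) (reflect-involutive z) (reflect-involutive z)

  sum-translate : ∀ c (f : Fin n → ℤ) → sum f ≡ sum (λ x → f (x ∙ c))
  sum-translate c = sum-reindex (_∙ c) (_// c) (//-rightDividesˡ c) (//-rightDividesʳ c)

  conv : (Fin n → ℤ) → (Fin n → ℤ) → Fin n → ℤ
  conv f g z = sum (λ x → f x * g (z // x))

  conv-comm : ∀ f g z → conv f g z ≡ conv g f z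
  conv-comm f g z = trans (sum-reflect z (λ x → f x * g (z // x))) (sum-cong-≗ (λ x →
    trans (cong (λ y → f (z // x) * g y) (reflect-involutive z x)) (ℤ.*-comm (f (z // x)) (g x))))

  conv-congʳ : ∀ f {g h} → (∀ x → g x ≡ h x) → ∀ z → conv f g z ≡ conv f h z
  conv-congʳ f g≗h z = sum-cong-≗ (λ x → cong (f x *_) (g≗h (z // x)))

  module _ (f g h : Fin n → ℤ) (z : Fin n) where

    conv-+ˡ : conv (λ x → f x + g x) h z ≡ conv f h z + conv g h z
    conv-+ˡ = trans (sum-cong-≗ (λ x → ℤ.*-distribʳ-+ (h (z // x)) (f x) (g x)))
                    (∑-distrib-+ (λ x → f x * h (z // x)) (λ x → g x * h (z // x)))

    conv--ˡ : conv (λ x → f x - g x) h z ≡ conv f h z - conv g h z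
    conv--ˡ = trans (sum-cong-≗ (λ x → [y-z]x≈yx-zx (h (z // x)) (f x) (g x)))
                    (∑-distrib-- (λ x → f x * h (z // x)) (λ x → g x * h (z // x)))

    conv-+ʳ : conv f (λ x → g x + h x) z ≡ conv f g z + conv f h z
    conv-+ʳ = trans (sum-cong-≗ (λ x → ℤ.*-distribˡ-+ (f x) (g (z // x)) (h (z // x))))
                    (∑-distrib-+ (λ x → f x * g (z // x)) (λ x → f x * h (z // x)))

    conv--ʳ : conv f (λ x → g x - h x) z ≡ conv f g z - conv f h z
    conv--ʳ = trans (sum-cong-≗ (λ x → x[y-z]≈xy-xz (f x) (g (z // x)) (h (z // x))))
                    (∑-distrib-- (λ x → f x * g (z // x)) (λ x → f x * h (z // x)))

  conv-*ˡ : ∀ k f g z → conv (λ x → k * f x) g z ≡ k * conv f g z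
  conv-*ˡ k f g z = trans (sum-cong-≗ (λ x → ℤ.*-assoc k (f x) (g (z // x))))
                          (sym (*-distribˡ-sum k (λ x → f x * g (z // x))))

  conv-constˡ : ∀ k g z → conv (λ _ → k) g z ≡ k * sum g
  conv-constˡ k g z = trans (sym (*-distribˡ-sum k (λ x → g (z // x)))) (cong (k *_) (sym (sum-reflect z g)))

  conv-constʳ : ∀ f k z → conv f (λ _ → k) z ≡ sum f * k
  conv-constʳ f k z = sym (*-distribʳ-sum k f)

  conv-δʳ : ∀ f a z → conv f (δ a) z ≡ f (z // a)
  conv-δʳ f a z = trans (sum-cong-≗ (λ x → trans (ℤ.*-comm (f x) _) (cong (_* f x) (δ-reflect x)))) (∑-δ (z // a) f)
    where
    δ-reflect : ∀ x → δ a (z // x) ≡ δ (z // a) x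
    δ-reflect = δ-inverse {σ = z //_} {τ = z //_} (reflect-involutive z) (reflect-involutive z) a

  ∑-conv : ∀ f g → sum (conv f g) ≡ sum f * sum g
  ∑-conv f g = begin
    sum (λ z → sum (λ x → f x * g (z // x)))  ≡⟨ ∑-comm (λ z x → f x * g (z // x)) ⟩
    sum (λ x → sum (λ z → f x * g (z // x)))  ≡⟨ sum-cong-≗ (λ x → sym (*-distribˡ-sum (f x) (λ z → g (z // x)))) ⟩
    sum (λ x → f x * sum (λ z → g (z // x)))  ≡⟨ sum-cong-≗ (λ x → cong (f x *_) (sym (sum-translate (x ⁻¹) g))) ⟩
    sum (λ x → f x * sum g)                   ≡⟨ *-distribʳ-sum (sum g) f ⟨
    sum f * sum g                             ∎
    where open ≡-Reasoning

  conv-difference-of-squares : ∀ f g z → conv (λ x → f x - g x) (λ x → f x + g x) z ≡ conv f f z - conv g g z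
  conv-difference-of-squares f g z = begin
    conv (λ x → f x - g x) f+g z                            ≡⟨ conv--ˡ f g f+g z ⟩
    conv f f+g z - conv g f+g z                             ≡⟨ cong₂ _-_ (conv-+ʳ f f g z) (conv-+ʳ g f g z) ⟩
    (conv f f z + conv f g z) - (conv g f z + conv g g z)   ≡⟨ cong (λ w → (conv f f z + conv f g z) - (w + conv g g z)) (conv-comm g f z) ⟩
    (conv f f z + conv f g z) - (conv f g z + conv g g z)   ≡⟨ cancel (conv f f z) (conv f g z) (conv g g z) ⟩
    conv f f z - conv g g z                                 ∎
    where
    open ≡-Reasoning
    f+g = λ x → f x + g x
    cancel : ∀ p q r → (p + q) - (q + r) ≡ p - r
    cancel = solve-∀

  module _ {A B : Subset n} (A∪B≡⊤ : A ∪ B ≡ ⊤) (autoconv≡ : ∀ z → conv (χ A) (χ A) z ≡ conv (χ B) (χ B) z) where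

    private
      a b c e D : Fin n → ℤ
      a = χ A
      b = χ B
      c = χ (A ∩ B)
      e = χ (∁ (A ∩ B))
      D x = a x - b x

      D≡1+c-2b : ∀ x → D x ≡ (1ℤ + c x) - ℤ.+ 2 * b x
      D≡1+c-2b x = trans (rearrange (a x) (b x)) (cong (_- ℤ.+ 2 * b x) (χ-∪-∩ A∪B≡⊤ x))
        where
        rearrange : ∀ p q → p - q ≡ (p + q) - ℤ.+ 2 * q
        rearrange = solve-∀

    conv-difference-1+χ∩≡0 : ∀ z → conv D (λ x → 1ℤ + c x) z ≡ 0ℤ
    conv-difference-1+χ∩≡0 z = begin
      conv D (λ x → 1ℤ + c x) z   ≡⟨ conv-congʳ D (χ-∪-∩ A∪B≡⊤) z ⟨
      conv D (λ x → a x + b x) z  ≡⟨ conv-difference-of-squares a b z ⟩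
      conv a a z - conv b b z     ≡⟨ cong (_- conv b b z) (autoconv≡ z) ⟩
      conv b b z - conv b b z     ≡⟨ ℤ.+-inverseʳ (conv b b z) ⟩
      0ℤ                          ∎
      where open ≡-Reasoning

    sum-difference≡0 : sum D ≡ 0ℤ
    sum-difference≡0 with ℤ.i*j≡0⇒i≡0∨j≡0 (sum D) ΣD*Σ[1+c]≡0
      where
      ΣD*Σ[1+c]≡0 : sum D * sum (λ x → 1ℤ + c x) ≡ 0ℤ
      ΣD*Σ[1+c]≡0 = trans (sym (∑-conv D (λ x → 1ℤ + c x)))
                         (trans (sum-cong-≗ conv-difference-1+χ∩≡0) (sum-replicate-zero n))
    ... | inj₁ ΣD≡0     = ΣD≡0
    ... | inj₂ Σ[1+c]≡0 = ⊥-elim (1+nonneg≢0 (c≥0 ε) (nonneg-sum≡0⇒≡0 1+c≥0 Σ[1+c]≡0 ε))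
      where
      c≥0 = binary-nonneg (χ-binary (A ∩ B))
      1+c≥0 : ∀ x → 0ℤ ℤ.≤ 1ℤ + c x
      1+c≥0 x = ℤ.+-mono-≤ (ℤ.+≤+ ℕ.z≤n) (c≥0 x)
      1+nonneg≢0 : ∀ {i} → 0ℤ ℤ.≤ i → ¬ 1ℤ + i ≡ 0ℤ
      1+nonneg≢0 (ℤ.+≤+ _) ()

    conv-difference-χ∩≡0 : ∀ z → conv D c z ≡ 0ℤ
    conv-difference-χ∩≡0 z = begin
      conv D c z                        ≡⟨ ℤ.+-identityˡ (conv D c z) ⟨
      0ℤ + conv D c z                   ≡⟨ cong (_+ conv D c z) (trans (ℤ.*-identityʳ (sum D)) sum-difference≡0) ⟨
      sum D * 1ℤ + conv D c z           ≡⟨ cong (_+ conv D c z) (conv-constʳ D 1ℤ z) ⟨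
      conv D (λ _ → 1ℤ) z + conv D c z  ≡⟨ conv-+ʳ D (λ _ → 1ℤ) c z ⟨
      conv D (λ x → 1ℤ + c x) z         ≡⟨ conv-difference-1+χ∩≡0 z ⟩
      0ℤ                                ∎
      where open ≡-Reasoning

    conv-difference-χ∁∩≡0 : ∀ z → conv D e z ≡ 0ℤ
    conv-difference-χ∁∩≡0 z = begin
      conv D e z                        ≡⟨ conv-congʳ D (χ-∁ (A ∩ B)) z ⟩
      conv D (λ x → 1ℤ - c x) z         ≡⟨ conv--ʳ D (λ _ → 1ℤ) c z ⟩
      conv D (λ _ → 1ℤ) z - conv D c z  ≡⟨ cong₂ _-_ (trans (conv-constʳ D 1ℤ z) (trans (ℤ.*-identityʳ (sum D)) sum-difference≡0))
                                                     (conv-difference-χ∩≡0 z) ⟩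
      0ℤ                                ∎
      where open ≡-Reasoning

    autoconv-χ∩-even : sum c ≡ ℤ.+ 4 → ∀ z → ∃ λ w → conv c c z ≡ ℤ.+ 2 * w
    autoconv-χ∩-even Σc≡4 z = conv b c z - ℤ.+ 2 , (begin
      conv c c z                                                                 ≡⟨ rearrange (conv c c z) (conv b c z) ⟩
      (ℤ.+ 4 + conv c c z - ℤ.+ 2 * conv b c z) + ℤ.+ 2 * (conv b c z - ℤ.+ 2)  ≡⟨ cong (_+ ℤ.+ 2 * (conv b c z - ℤ.+ 2)) expand ⟨
      conv D c z + ℤ.+ 2 * (conv b c z - ℤ.+ 2)                                  ≡⟨ cong (_+ ℤ.+ 2 * (conv b c z - ℤ.+ 2)) (conv-difference-χ∩≡0 z) ⟩
      0ℤ + ℤ.+ 2 * (conv b c z - ℤ.+ 2)                                          ≡⟨ ℤ.+-identityˡ _ ⟩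
      ℤ.+ 2 * (conv b c z - ℤ.+ 2)                                               ∎)
      where
      open ≡-Reasoning
      rearrange : ∀ p q → p ≡ (ℤ.+ 4 + p - ℤ.+ 2 * q) + ℤ.+ 2 * (q - ℤ.+ 2)
      rearrange = solve-∀
      expand : conv D c z ≡ ℤ.+ 4 + conv c c z - ℤ.+ 2 * conv b c z
      expand = begin
        conv D c z                                                 ≡⟨ sum-cong-≗ (λ x → cong (_* c (z // x)) (D≡1+c-2b x)) ⟩
        conv (λ x → (1ℤ + c x) - ℤ.+ 2 * b x) c z                  ≡⟨ conv--ˡ (λ x → 1ℤ + c x) (λ x → ℤ.+ 2 * b x) c z ⟩
        conv (λ x → 1ℤ + c x) c z - conv (λ x → ℤ.+ 2 * b x) c z   ≡⟨ cong₂ _-_ (conv-+ˡ (λ _ → 1ℤ) c c z) (conv-*ˡ (ℤ.+ 2) b c z) ⟩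
        conv (λ _ → 1ℤ) c z + conv c c z - ℤ.+ 2 * conv b c z      ≡⟨ cong (λ v → v + conv c c z - ℤ.+ 2 * conv b c z)
                                                                           (trans (conv-constˡ 1ℤ c z) (trans (ℤ.*-identityˡ (sum c)) Σc≡4)) ⟩
        ℤ.+ 4 + conv c c z - ℤ.+ 2 * conv b c z                    ∎

    autoconv-χ∁∩-even : ∀ z → ∃ λ w → conv e e z ≡ ℤ.+ 2 * w
    autoconv-χ∁∩-even z = conv (λ x → 1ℤ - b x) e z , sym (ℤ.i-j≡0⇒i≡j _ _ (begin
      ℤ.+ 2 * conv (λ x → 1ℤ - b x) e z - conv e e z    ≡⟨ cong (_- conv e e z) (conv-*ˡ (ℤ.+ 2) (λ x → 1ℤ - b x) e z) ⟨
      conv (λ x → ℤ.+ 2 * (1ℤ - b x)) e z - conv e e z  ≡⟨ conv--ˡ (λ x → ℤ.+ 2 * (1ℤ - b x)) e e z ⟨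
      conv (λ x → ℤ.+ 2 * (1ℤ - b x) - e x) e z         ≡⟨ sum-cong-≗ (λ x → cong (_* e (z // x)) (D≡2[1-b]-e x)) ⟨
      conv D e z                                        ≡⟨ conv-difference-χ∁∩≡0 z ⟩
      0ℤ                                                ∎))
      where
      open ≡-Reasoning
      D≡2[1-b]-e : ∀ x → D x ≡ ℤ.+ 2 * (1ℤ - b x) - e x
      D≡2[1-b]-e x = begin
        D x                              ≡⟨ D≡1+c-2b x ⟩
        (1ℤ + c x) - ℤ.+ 2 * b x         ≡⟨ rearrange (b x) (c x) ⟩
        ℤ.+ 2 * (1ℤ - b x) - (1ℤ - c x)  ≡⟨ cong (λ v → ℤ.+ 2 * (1ℤ - b x) - v) (χ-∁ (A ∩ B) x) ⟨
        ℤ.+ 2 * (1ℤ - b x) - e x         ∎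
        where
        rearrange : ∀ q r → (1ℤ + r) - ℤ.+ 2 * q ≡ ℤ.+ 2 * (1ℤ - q) - (1ℤ - r)
        rearrange = solve-∀

  -- In ℤ_m with m ≡ 2 (mod 4), t = m/2 is the unique element of order 2.
  module Involution (t : Fin n) (t∙t≡ε : t ∙ t ≡ ε) (t≢ε : ¬ t ≡ ε)
                    (square-root-of-ε : ∀ x → x ∙ x ≡ ε → x ≡ ε ⊎ x ≡ t) where

    ∙t∙t : ∀ x → x ∙ t ∙ t ≡ x
    ∙t∙t x = trans (assoc x t t) (trans (cong (x ∙_) t∙t≡ε) (identityʳ x))

    x∙t≢x : ∀ x → ¬ x ∙ t ≡ x
    x∙t≢x x x∙t≡x = t≢ε (∙-cancelˡ x t ε (trans x∙t≡x (sym (identityʳ x))))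

    //t≡∙t : ∀ x → x // t ≡ x ∙ t
    //t≡∙t x = cong (x ∙_) (sym (inverseʳ-unique t t t∙t≡ε))

    //-∙t : ∀ z a → z // (a ∙ t) ≡ (z // a) ∙ t
    //-∙t z a = begin
      z ∙ (a ∙ t) ⁻¹     ≡⟨ cong (z ∙_) (⁻¹-∙-comm a t) ⟨
      z ∙ (a ⁻¹ ∙ t ⁻¹)  ≡⟨ assoc z (a ⁻¹) (t ⁻¹) ⟨
      (z // a) // t      ≡⟨ //t≡∙t (z // a) ⟩
      (z // a) ∙ t       ∎
      where open ≡-Reasoning

    square-roots : ∀ x y → x ∙ x ≡ y ∙ y → x ≡ y ⊎ x ≡ y ∙ t
    square-roots x y xx≡yy with square-root-of-ε (x // y) (begin
      (x ∙ y ⁻¹) ∙ (x ∙ y ⁻¹)  ≡⟨ interchange x (y ⁻¹) x (y ⁻¹) ⟩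
      (x ∙ x) ∙ (y ⁻¹ ∙ y ⁻¹)  ≡⟨ cong₂ _∙_ xx≡yy (⁻¹-∙-comm y y) ⟩
      (y ∙ y) // (y ∙ y)       ≡⟨ inverseʳ (y ∙ y) ⟩
      ε                        ∎)
      where open ≡-Reasoning
    ... | inj₁ x/y≡ε = inj₁ (x∙y⁻¹≈ε⇒x≈y x y x/y≡ε)
    ... | inj₂ x/y≡t = inj₂ (trans (sym (//-rightDividesˡ y x)) (trans (cong (_∙ y) x/y≡t) (comm t y)))

    square-roots⁻¹ : ∀ x y → x ≡ y ⊎ x ≡ y ∙ t → x ∙ x ≡ y ∙ y
    square-roots⁻¹ x y (inj₁ refl) = refl
    square-roots⁻¹ x y (inj₂ refl) = trans (interchange y t y t) (trans (cong ((y ∙ y) ∙_) t∙t≡ε) (identityʳ (y ∙ y)))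

    Invariant : (Fin n → ℤ) → Set
    Invariant f = ∀ x → f (x ∙ t) ≡ f x

    pair : Fin n → Fin n → ℤ
    pair a x = δ a x + δ (a ∙ t) x

    pair-∈ : ∀ {a x} → x ≡ a ⊎ x ≡ a ∙ t → pair a x ≡ 1ℤ
    pair-∈ {a} (inj₁ refl) = cong₂ _+_ (δ-refl {c = a} refl) (δ-≢ (λ a≡a∙t → x∙t≢x a (sym a≡a∙t)))
    pair-∈ {a} (inj₂ refl) = cong₂ _+_ (δ-≢ (x∙t≢x a)) (δ-refl {c = a ∙ t} refl)

    pair-∉ : ∀ {a x} → ¬ x ≡ a → ¬ x ≡ a ∙ t → pair a x ≡ 0ℤ
    pair-∉ x≢a x≢a∙t = cong₂ _+_ (δ-≢ x≢a) (δ-≢ x≢a∙t)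

    pair-invariant : ∀ a → Invariant (pair a)
    pair-invariant a x = begin
      δ a (x ∙ t) + δ (a ∙ t) (x ∙ t)  ≡⟨ cong₂ _+_ (δ-∙t a) (δ-∙t (a ∙ t)) ⟩
      δ (a ∙ t) x + δ (a ∙ t ∙ t) x    ≡⟨ cong (λ c → δ (a ∙ t) x + δ c x) (∙t∙t a) ⟩
      δ (a ∙ t) x + δ a x              ≡⟨ ℤ.+-comm (δ (a ∙ t) x) (δ a x) ⟩
      pair a x                         ∎
      where
      open ≡-Reasoning
      δ-∙t : ∀ c → δ c (x ∙ t) ≡ δ (c ∙ t) x
      δ-∙t c = δ-inverse {σ = _∙ t} {τ = _∙ t} ∙t∙t ∙t∙t c x

    sum-pair : ∀ a → sum (pair a) ≡ ℤ.+ 2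
    sum-pair a = trans (∑-distrib-+ (δ a) (δ (a ∙ t))) (cong₂ _+_ (sum-δ a) (sum-δ (a ∙ t)))

    autoconv-at-square : ∀ {s} → Binary s → ∀ y → ∃ λ L → conv s s (y ∙ y) ≡ ℤ.+ 2 * L + (s y + s (y ∙ t))
    autoconv-at-square {s} bs y =
      L , trans (sum-involution σ (reflect-involutive z) F Fσ) (cong (ℤ.+ 2 * L +_) ∑-fixed)
      where
      z = y ∙ y
      σ = z //_
      F : Fin n → ℤ
      F x = s x * s (σ x)
      Fσ : ∀ x → F (σ x) ≡ F x
      Fσ x = trans (cong (λ v → s (σ x) * s v) (reflect-involutive z x)) (ℤ.*-comm (s (σ x)) (s x))
      L = sum (λ x → F x * lt x (σ x))
      fixed-point⇔ : ∀ x → x ≡ σ x ⇔ (x ≡ y ⊎ x ≡ y ∙ t)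
      fixed-point⇔ x = mk⇔ (λ x≡σx → square-roots x y (trans (cong (_∙ x) x≡σx) (//-rightDividesˡ x z)))
                           (λ x∈ → trans (sym (//-rightDividesʳ x x)) (cong (_// x) (square-roots⁻¹ x y x∈)))
      fixed : ∀ x → F x * δ (σ x) x ≡ pair y x * s x
      fixed x with x Fin.≟ σ x
      ... | yes x≡σx = begin
        s x * s (σ x) * 1ℤ  ≡⟨ ℤ.*-identityʳ (s x * s (σ x)) ⟩
        s x * s (σ x)       ≡⟨ cong (λ v → s x * s v) x≡σx ⟨
        s x * s x           ≡⟨ binary-square (bs x) ⟩
        s x                 ≡⟨ ℤ.*-identityˡ (s x) ⟨
        1ℤ * s x            ≡⟨ cong (_* s x) (pair-∈ (Equivalence.to (fixed-point⇔ x) x≡σx)) ⟨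
        pair y x * s x      ∎
        where open ≡-Reasoning
      ... | no x≢σx = trans (trans (ℤ.*-zeroʳ (F x)) (sym (ℤ.*-zeroˡ (s x))))
                            (cong (_* s x) (sym (pair-∉ (x≢σx ∘ from ∘ inj₁) (x≢σx ∘ from ∘ inj₂))))
        where from = Equivalence.from (fixed-point⇔ x)
      ∑-fixed : sum (λ x → F x * δ (σ x) x) ≡ s y + s (y ∙ t)
      ∑-fixed = trans (sum-cong-≗ fixed)
        (trans (sum-cong-≗ (λ x → ℤ.*-distribʳ-+ (s x) (δ y x) (δ (y ∙ t) x)))
        (trans (∑-distrib-+ (λ x → δ y x * s x) (λ x → δ (y ∙ t) x * s x))
               (cong₂ _+_ (∑-δ y s) (∑-δ (y ∙ t) s))))

    even-autoconv⇒invariant : ∀ {s} → Binary s → (∀ z → ∃ λ w → conv s s z ≡ ℤ.+ 2 * w) → Invariant s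
    even-autoconv⇒invariant {s} bs even y =
      let L , s∗s≡2L+sy+syt = autoconv-at-square bs y
          w , s∗s≡2w       = even (y ∙ y)
      in sym (binary-sum-even⇒≡ (bs y) (bs (y ∙ t)) (w - L) (begin
        s y + s (y ∙ t)                                ≡⟨ rearrange L (s y + s (y ∙ t)) ⟩
        (ℤ.+ 2 * L + (s y + s (y ∙ t))) - ℤ.+ 2 * L    ≡⟨ cong (_- ℤ.+ 2 * L) (trans (sym s∗s≡2L+sy+syt) s∗s≡2w) ⟩
        ℤ.+ 2 * w - ℤ.+ 2 * L                          ≡⟨ x[y-z]≈xy-xz (ℤ.+ 2) w L ⟨
        ℤ.+ 2 * (w - L)                                ∎))
      where
      open ≡-Reasoning
      rearrange : ∀ l r → r ≡ (ℤ.+ 2 * l + r) - ℤ.+ 2 * l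
      rearrange = solve-∀

    module _ {s : Fin n → ℤ} (bs : Binary s) (invs : Invariant s) {a : Fin n} (sa≡1 : s a ≡ 1ℤ) where

      remove-pair-binary : Binary (λ x → s x - pair a x)
      remove-pair-binary x with x Fin.≟ a ⊎-dec x Fin.≟ a ∙ t
      ... | yes x∈pair = inj₁ (cong₂ _-_ (s≡1 x∈pair) (pair-∈ x∈pair))
        where
        s≡1 : x ≡ a ⊎ x ≡ a ∙ t → s x ≡ 1ℤ
        s≡1 (inj₁ refl) = sa≡1
        s≡1 (inj₂ refl) = trans (invs a) sa≡1
      ... | no x∉pair rewrite pair-∉ (x∉pair ∘ inj₁) (x∉pair ∘ inj₂) | ℤ.+-identityʳ (s x) = bs x

      remove-pair-invariant : Invariant (λ x → s x - pair a x)
      remove-pair-invariant x = cong₂ _-_ (invs x) (pair-invariant a x)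

      sum-remove-pair : sum (λ x → s x - pair a x) ≡ sum s - ℤ.+ 2
      sum-remove-pair = trans (∑-distrib-- s (pair a)) (cong (λ v → sum s - v) (sum-pair a))

    one-pair : ∀ {s} → Binary s → Invariant s → sum s ≡ ℤ.+ 2 → ∃ λ a → ∀ x → s x ≡ pair a x
    one-pair {s} bs invs Σs≡2 with binary-sum≢0⇒∃≡1 bs (λ Σs≡0 → contradiction (trans (sym Σs≡2) Σs≡0) λ ())
    ... | a , sa≡1 = a , λ x → ℤ.i-j≡0⇒i≡j (s x) (pair a x)
      (nonneg-sum≡0⇒≡0 (binary-nonneg (remove-pair-binary bs invs sa≡1))
                       (trans (sum-remove-pair bs invs sa≡1) (cong (_- ℤ.+ 2) Σs≡2)) x)

    two-pairs : ∀ {s} → Binary s → Invariant s → sum s ≡ ℤ.+ 4 → ∃ λ a → ∃ λ b → ∀ x → s x ≡ pair a x + pair b x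
    two-pairs {s} bs invs Σs≡4 with binary-sum≢0⇒∃≡1 bs (λ Σs≡0 → contradiction (trans (sym Σs≡4) Σs≡0) λ ())
    ... | a , sa≡1 with one-pair (remove-pair-binary bs invs sa≡1) (remove-pair-invariant bs invs sa≡1)
                                 (trans (sum-remove-pair bs invs sa≡1) (cong (_- ℤ.+ 2) Σs≡4))
    ...   | b , rest≡pair-b = a , b , λ x →
      trans (rearrange (s x) (pair a x)) (trans (cong (_+ pair a x) (rest≡pair-b x)) (ℤ.+-comm (pair b x) (pair a x)))
      where
      rearrange : ∀ i j → i ≡ (i - j) + j
      rearrange = solve-∀

    symmetrise : (Fin n → ℤ) → Fin n → ℤ
    symmetrise f x = f x + f (x ∙ t)

    symmetrise-invariant : ∀ f → Invariant (symmetrise f)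
    symmetrise-invariant f x = trans (cong (f (x ∙ t) +_) (cong f (∙t∙t x))) (ℤ.+-comm (f (x ∙ t)) (f x))

    conv-∙t : ∀ f g z → conv (λ x → f (x ∙ t)) (λ x → g (x ∙ t)) z ≡ conv f g z
    conv-∙t f g z = trans (sum-translate t _) (sum-cong-≗ (λ x →
      cong₂ (λ p q → f p * g q) (∙t∙t x) (trans (cong (_∙ t) (//-∙t z x)) (∙t∙t (z // x)))))

    conv-pairʳ : ∀ f a z → conv f (pair a) z ≡ symmetrise f (z // a)
    conv-pairʳ f a z = begin
      conv f (pair a) z                      ≡⟨ conv-+ʳ f (δ a) (δ (a ∙ t)) z ⟩
      conv f (δ a) z + conv f (δ (a ∙ t)) z  ≡⟨ cong₂ _+_ (conv-δʳ f a z) (conv-δʳ f (a ∙ t) z) ⟩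
      f (z // a) + f (z // (a ∙ t))          ≡⟨ cong (λ v → f (z // a) + f v) (//-∙t z a) ⟩
      symmetrise f (z // a)                  ∎
      where open ≡-Reasoning

    conv-pair≡0⇒symmetrise≡0 : ∀ f a → (∀ z → conv f (pair a) z ≡ 0ℤ) → ∀ y → symmetrise f y ≡ 0ℤ
    conv-pair≡0⇒symmetrise≡0 f a conv≡0 y =
      trans (cong (symmetrise f) (sym (//-rightDividesʳ a y))) (trans (sym (conv-pairʳ f a (y ∙ a))) (conv≡0 (y ∙ a)))

    module _ {u : Fin n → ℤ} (invu : Invariant u) {d : Fin n} (alternating : ∀ x → u x + u (x ∙ d) ≡ 0ℤ) where

      step : ∀ x → u (x ∙ d) ≡ - u x
      step x = ℤ-Group.inverseʳ-unique (u x) (u (x ∙ d)) (alternating x)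

      even-steps : ∀ j x → u (x ∙ ((j ℕ.+ j) · d)) ≡ u x
      even-steps zero    x = cong u (identityʳ x)
      even-steps (suc j) x = begin
        u (x ∙ ((suc j ℕ.+ suc j) · d))      ≡⟨ cong (λ i → u (x ∙ (i · d))) (ℕ.+-suc (suc j) j) ⟩
        u (x ∙ (d ∙ (d ∙ (j ℕ.+ j) · d)))    ≡⟨ cong u (trans (assoc (x ∙ d) d ((j ℕ.+ j) · d)) (assoc x d (d ∙ (j ℕ.+ j) · d))) ⟨
        u (x ∙ d ∙ d ∙ (j ℕ.+ j) · d)        ≡⟨ even-steps j (x ∙ d ∙ d) ⟩
        u (x ∙ d ∙ d)                        ≡⟨ trans (step (x ∙ d)) (cong -_ (step x)) ⟩
        - - u x                              ≡⟨ ℤ.neg-involutive (u x) ⟩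
        u x                                  ∎
        where open ≡-Reasoning

      odd-steps : ∀ j x → u (x ∙ (suc (j ℕ.+ j) · d)) ≡ - u x
      odd-steps j x = trans (cong u (sym (assoc x d ((j ℕ.+ j) · d)))) (trans (even-steps j (x ∙ d)) (step x))

      alternating-vanishes : ∀ j → suc (j ℕ.+ j) · d ≡ ε ⊎ suc (j ℕ.+ j) · d ≡ t → ∀ x → u x ≡ 0ℤ
      alternating-vanishes j kd∈⟨t⟩ x = i≡-i⇒i≡0 (trans (sym (u-fixed kd∈⟨t⟩)) (odd-steps j x))
        where
        u-fixed : suc (j ℕ.+ j) · d ≡ ε ⊎ suc (j ℕ.+ j) · d ≡ t → u (x ∙ (suc (j ℕ.+ j) · d)) ≡ u x
        u-fixed (inj₁ kd≡ε) = cong u (trans (cong (x ∙_) kd≡ε) (identityʳ x))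
        u-fixed (inj₂ kd≡t) = trans (cong (λ v → u (x ∙ v)) kd≡t) (invu x)
        i≡-i⇒i≡0 : ∀ {i} → i ≡ - i → i ≡ 0ℤ
        i≡-i⇒i≡0 {ℤ.+ zero}      _ = refl
        i≡-i⇒i≡0 {ℤ.+[1+ _ ]} ()
        i≡-i⇒i≡0 {ℤ.-[1+ _ ]} ()

    translate⇒autoconv≡ : ∀ {A B : Subset n} → (∀ x → lookup B x ≡ lookup A (x ∙ t)) →
                          ∀ z → conv (χ A) (χ A) z ≡ conv (χ B) (χ B) z
    translate⇒autoconv≡ {A} {B} B≗A∙t z = sym (trans
      (sum-cong-≗ (λ x → cong₂ _*_ (cong toℤ (B≗A∙t x)) (cong toℤ (B≗A∙t (z // x)))))
      (conv-∙t (χ A) (χ A) z))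

    -- In ℤ_{2k} with k = 2j + 1 this holds because (k · d) ∙ (k · d) = 2k · d = 0.
    module _ (j : ℕ) (odd-multiple : ∀ d → suc (j ℕ.+ j) · d ≡ ε ⊎ suc (j ℕ.+ j) · d ≡ t) where

      conv-pairs≡0⇒symmetrise≡0 : ∀ f a b → (∀ z → conv f (λ x → pair a x + pair b x) z ≡ 0ℤ) →
                                  ∀ y → symmetrise f y ≡ 0ℤ
      conv-pairs≡0⇒symmetrise≡0 f a b conv≡0 =
        alternating-vanishes (symmetrise-invariant f) alternating j (odd-multiple (a // b))
        where
        alternating : ∀ y → symmetrise f y + symmetrise f (y ∙ (a // b)) ≡ 0ℤ
        alternating y = begin
          symmetrise f y + symmetrise f (y ∙ (a // b))               ≡⟨ cong₂ (λ p q → symmetrise f p + symmetrise f q)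
                                                                              (//-rightDividesʳ a y) (assoc y a (b ⁻¹)) ⟨
          symmetrise f ((y ∙ a) // a) + symmetrise f ((y ∙ a) // b)  ≡⟨ cong₂ _+_ (conv-pairʳ f a (y ∙ a)) (conv-pairʳ f b (y ∙ a)) ⟨
          conv f (pair a) (y ∙ a) + conv f (pair b) (y ∙ a)          ≡⟨ conv-+ʳ f (pair a) (pair b) (y ∙ a) ⟨
          conv f (λ x → pair a x + pair b x) (y ∙ a)                 ≡⟨ conv≡0 (y ∙ a) ⟩
          0ℤ                                                         ∎
          where open ≡-Reasoning

      conv-invariant≡0⇒symmetrise≡0 : ∀ f {s} → Binary s → Invariant s → sum s ≡ ℤ.+ 2 ⊎ sum s ≡ ℤ.+ 4 →
                                      (∀ z → conv f s z ≡ 0ℤ) → ∀ y → symmetrise f y ≡ 0ℤ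
      conv-invariant≡0⇒symmetrise≡0 f {s} bs invs (inj₁ Σs≡2) conv≡0 =
        let a , s≗pair = one-pair bs invs Σs≡2 in
        conv-pair≡0⇒symmetrise≡0 f a (λ z → trans (conv-congʳ f {h = s} (sym ∘ s≗pair) z) (conv≡0 z))
      conv-invariant≡0⇒symmetrise≡0 f {s} bs invs (inj₂ Σs≡4) conv≡0 =
        let a , b , s≗pairs = two-pairs bs invs Σs≡4 in
        conv-pairs≡0⇒symmetrise≡0 f a b (λ z → trans (conv-congʳ f {h = s} (sym ∘ s≗pairs) z) (conv≡0 z))

      autoconv≡⇒translate : ∀ {A B : Subset n} → A ∪ B ≡ ⊤ →
        ∣ A ∩ B ∣ ≡ 4 ⊎ ∣ ∁ (A ∩ B) ∣ ≡ 2 ⊎ ∣ ∁ (A ∩ B) ∣ ≡ 4 →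
        (∀ z → conv (χ A) (χ A) z ≡ conv (χ B) (χ B) z) → ∀ x → lookup B x ≡ lookup A (x ∙ t)
      autoconv≡⇒translate {A} {B} A∪B≡⊤ card autoconv≡ x =
        difference-cancels (lookup A x) (lookup B x) (lookup A (x ∙ t)) (lookup B (x ∙ t))
          (∪≡⊤⇒covers A∪B≡⊤ x) (∪≡⊤⇒covers A∪B≡⊤ (x ∙ t)) (symmetrise-difference≡0 card x)
        where
        D : Fin n → ℤ
        D x = χ A x - χ B x
        symmetrise-difference≡0 : ∣ A ∩ B ∣ ≡ 4 ⊎ ∣ ∁ (A ∩ B) ∣ ≡ 2 ⊎ ∣ ∁ (A ∩ B) ∣ ≡ 4 → ∀ y → symmetrise D y ≡ 0ℤ
        symmetrise-difference≡0 (inj₁ ∣A∩B∣≡4) =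
          conv-invariant≡0⇒symmetrise≡0 D (χ-binary (A ∩ B))
            (even-autoconv⇒invariant (χ-binary (A ∩ B)) (autoconv-χ∩-even A∪B≡⊤ autoconv≡ Σc≡4))
            (inj₂ Σc≡4) (conv-difference-χ∩≡0 A∪B≡⊤ autoconv≡)
          where Σc≡4 = trans (sum-χ (A ∩ B)) (cong ℤ.+_ ∣A∩B∣≡4)
        symmetrise-difference≡0 (inj₂ ∣∁∣≡2⊎4) =
          conv-invariant≡0⇒symmetrise≡0 D (χ-binary (∁ (A ∩ B)))
            (even-autoconv⇒invariant (χ-binary (∁ (A ∩ B))) (autoconv-χ∁∩-even A∪B≡⊤ autoconv≡))
            (Sum.map Σe≡ Σe≡ ∣∁∣≡2⊎4) (conv-difference-χ∁∩≡0 A∪B≡⊤ autoconv≡)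
          where
          Σe≡ : ∀ {k} → ∣ ∁ (A ∩ B) ∣ ≡ k → sum (χ (∁ (A ∩ B))) ≡ ℤ.+ k
          Σe≡ ∣∁∣≡k = trans (sum-χ (∁ (A ∩ B))) (cong ℤ.+_ ∣∁∣≡k)
        difference-cancels : ∀ p q p′ q′ → p ∨ q ≡ true → p′ ∨ q′ ≡ true →
                             (toℤ p - toℤ q) + (toℤ p′ - toℤ q′) ≡ 0ℤ → q ≡ p′
        difference-cancels true  true  true  true  _ _ _  = refl
        difference-cancels true  false false true  _ _ _  = refl
        difference-cancels false true  true  false _ _ _  = refl
        difference-cancels true  true  true  false _ _ ()
        difference-cancels true  true  false true  _ _ ()
        difference-cancels true  false true  true  _ _ ()
        difference-cancels true  false true  false _ _ ()
        difference-cancels false true  true  true  _ _ ()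
        difference-cancels false true  false true  _ _ ()

-- ℤ_m for m twice an odd number

module ZModConvolution (m : ℕ) .{{_ : NonZero m}} where

  open import Data.Nat.DivMod using (m*n%n≡0; m<n⇒m%n≡m)
  open import Data.Nat.Divisibility using (m%n≡0⇒n∣m)
  open ZMod m
  open Convolution +ₘ-isAbelianGroup
  open import Algebra.Properties.AbelianGroup G using (//-rightDividesˡ; //-rightDividesʳ)
  open import Algebra.Properties.Monoid.Mult (AbelianGroup.monoid G) using () renaming (×-homo-+ to ·-homo-+)

  R≡autoconv : ∀ (A : Subset m) z → ℤ.+ R A z ≡ conv (χ A) (χ A) z
  R≡autoconv A z = trans (count-cartesianProduct _ {m} {m} id id) (sum-cong-≗ row)
    where
    row : ∀ i → sum (λ j → toℤ (mem i A ∧ mem j A ∧ ⌊ (i +ₘ j) Fin.≟ z ⌋)) ≡ χ A i * χ A (z // i)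
    row i = begin
      sum (λ j → toℤ (mem i A ∧ mem j A ∧ ⌊ (i +ₘ j) Fin.≟ z ⌋))  ≡⟨ sum-cong-≗ entry ⟩
      sum (λ j → χ A i * (δ (z // i) j * χ A j))                 ≡⟨ *-distribˡ-sum (χ A i) (λ j → δ (z // i) j * χ A j) ⟨
      χ A i * sum (λ j → δ (z // i) j * χ A j)                   ≡⟨ cong (χ A i *_) (∑-δ (z // i) (χ A)) ⟩
      χ A i * χ A (z // i)                                       ∎
      where
      open ≡-Reasoning
      i+j≡z⇔j≡z-i : ∀ j → δ z (i +ₘ j) ≡ δ (z // i) j
      i+j≡z⇔j≡z-i = δ-inverse {σ = i +ₘ_} {τ = _// i}
        (λ x → trans (cong (_// i) (+ₘ-comm i x)) (//-rightDividesʳ i x))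
        (λ c → trans (+ₘ-comm i (c // i)) (//-rightDividesˡ i c)) z
      entry : ∀ j → toℤ (mem i A ∧ mem j A ∧ ⌊ (i +ₘ j) Fin.≟ z ⌋) ≡ χ A i * (δ (z // i) j * χ A j)
      entry j = begin
        toℤ (mem i A ∧ mem j A ∧ ⌊ i+j≟z ⌋)                   ≡⟨ trans (toℤ-∧ (mem i A) _) (cong (toℤ (mem i A) *_) (toℤ-∧ (mem j A) _)) ⟩
        toℤ (mem i A) * (toℤ (mem j A) * toℤ ⌊ i+j≟z ⌋)       ≡⟨ cong₂ (λ p q → toℤ p * (toℤ q * toℤ ⌊ i+j≟z ⌋)) (mem≡lookup i A) (mem≡lookup j A) ⟩
        χ A i * (χ A j * toℤ ⌊ i+j≟z ⌋)                       ≡⟨ cong (λ v → χ A i * (χ A j * v)) (trans (toℤ-isYes i+j≟z) (i+j≡z⇔j≡z-i j)) ⟩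
        χ A i * (χ A j * δ (z // i) j)                        ≡⟨ cong (χ A i *_) (ℤ.*-comm (χ A j) (δ (z // i) j)) ⟩
        χ A i * (δ (z // i) j * χ A j)                        ∎
        where i+j≟z = (i +ₘ j) Fin.≟ z

  ·-[] : ∀ k a → k · a ≡ [ k ℕ.* Fin.toℕ a ]ₘ
  ·-[] zero    a = refl
  ·-[] (suc k) a = trans (cong₂ _+ₘ_ (sym ([]-toℕ a)) (·-[] k a)) (sym ([]-+ (Fin.toℕ a) (k ℕ.* Fin.toℕ a)))

  m·≡𝟘 : ∀ a → m · a ≡ 𝟘ₘ
  m·≡𝟘 a = trans (·-[] m a) ([]-≡𝟘 (trans (cong (_% m) (ℕ.*-comm m (Fin.toℕ a))) (m*n%n≡0 (Fin.toℕ a) m)))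

  module TwiceOdd (j : ℕ) (m≡h+h : m ≡ suc (j ℕ.+ j) ℕ.+ suc (j ℕ.+ j)) where

    h : ℕ
    h = suc (j ℕ.+ j)

    [h] : Fin m
    [h] = [ h ]ₘ

    [h]+[h]≡𝟘 : [h] +ₘ [h] ≡ 𝟘ₘ
    [h]+[h]≡𝟘 = trans (sym ([]-+ h h)) (trans (cong [_]ₘ (sym m≡h+h)) ([]-≡𝟘 (n%n≡0 m)))
      where open import Data.Nat.DivMod using (n%n≡0)

    [h]≢𝟘 : ¬ [h] ≡ 𝟘ₘ
    [h]≢𝟘 [h]≡𝟘 with trans (sym (trans (toℕ-[] h) (m<n⇒m%n≡m h<m))) (trans (cong Fin.toℕ [h]≡𝟘) toℕ-𝟘)
      where
      h<m : h ℕ.< m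
      h<m = subst (h ℕ.<_) (sym m≡h+h) (ℕ.m<m+n h ℕ.z<s)
    ... | ()

    double≡𝟘 : ∀ x → x +ₘ x ≡ 𝟘ₘ → x ≡ 𝟘ₘ ⊎ x ≡ [h]
    double≡𝟘 x x+x≡𝟘 = Sum.map (λ tx≡0 → trans (sym ([]-toℕ x)) (cong [_]ₘ tx≡0))
                                (λ tx≡h → trans (sym ([]-toℕ x)) (cong [_]ₘ tx≡h))
                                (double-divisible (subst (tx ℕ.<_) m≡h+h (Fin.toℕ<n x))
                                                  (subst (_∣ (tx ℕ.+ tx)) m≡h+h (m%n≡0⇒n∣m (tx ℕ.+ tx) m tx+tx%m≡0)))
      where
      tx = Fin.toℕ x
      tx+tx%m≡0 : (tx ℕ.+ tx) % m ≡ 0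
      tx+tx%m≡0 = trans (sym (toℕ-[] (tx ℕ.+ tx))) (trans (cong Fin.toℕ x+x≡𝟘) toℕ-𝟘)

    open Involution [h] [h]+[h]≡𝟘 [h]≢𝟘 double≡𝟘

    odd-multiple : ∀ d → h · d ≡ 𝟘ₘ ⊎ h · d ≡ [h]
    odd-multiple d = double≡𝟘 (h · d) (trans (sym (·-homo-+ d h h)) (trans (cong (_· d) (sym m≡h+h)) (m·≡𝟘 d)))

    ⊕[h]⇔translate : ∀ {A B : Subset m} → B ≡ A ⊕ [h] ⇔ (∀ x → lookup B x ≡ lookup A (x +ₘ [h]))
    ⊕[h]⇔translate {A} {B} = mk⇔
      (λ B≡A⊕[h] x → trans (cong (λ S → lookup S x) B≡A⊕[h]) (trans (Vec.lookup∘tabulate _ x) (cong (lookup A) (-[h]≡+[h] x))))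
      (λ B≗A+[h] → trans (sym (Vec.tabulate∘lookup B))
                         (Vec.tabulate-cong (λ x → trans (B≗A+[h] x) (cong (lookup A) (sym (-[h]≡+[h] x))))))
      where
      -[h]≡+[h] : ∀ x → x -ₘ [h] ≡ x +ₘ [h]
      -[h]≡+[h] x = trans (-ₘ≡+ₘnegₘ x [h]) (//t≡∙t x)

    -- Truncated subtraction: for m = 2 the complement of a set of size m ∸ 4 = 0 has size 2, not 4.
    ∣∁∣≡2⊎4 : ∀ {S : Subset m} → ∣ S ∣ ≡ m ∸ 4 → ∣ ∁ S ∣ ≡ 2 ⊎ ∣ ∁ S ∣ ≡ 4
    ∣∁∣≡2⊎4 {S} ∣S∣≡m∸4 = subst (λ k → k ≡ 2 ⊎ k ≡ 4)
      (sym (trans (∣∁p∣≡n∸∣p∣ S) (trans (cong (m ∸_) ∣S∣≡m∸4) (cong (λ k → k ∸ (k ∸ 4)) m≡h+h))))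
      (twice-odd∸[twice-odd∸4] j)
      where
      twice-odd∸[twice-odd∸4] : ∀ j → let k = suc (j ℕ.+ j) ℕ.+ suc (j ℕ.+ j) in k ∸ (k ∸ 4) ≡ 2 ⊎ k ∸ (k ∸ 4) ≡ 4
      twice-odd∸[twice-odd∸4] zero    = inj₁ refl
      twice-odd∸[twice-odd∸4] (suc j) = inj₂ (ℕ.m∸[m∸n]≡n (ℕ.+-mono-≤ {2} {k} {2} {k} 2≤k 2≤k))
        where
        k = suc (suc j ℕ.+ suc j)
        2≤k : 2 ℕ.≤ k
        2≤k = ℕ.s≤s (ℕ.s≤s ℕ.z≤n)

    R≡⇔⊕[h] : ∀ {A B : Subset m} → A ∪ B ≡ ⊤ → ∣ A ∩ B ∣ ≡ 4 ⊎ ∣ A ∩ B ∣ ≡ m ∸ 4 →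
              (∀ z → R A z ≡ R B z) ⇔ (B ≡ A ⊕ [h])
    R≡⇔⊕[h] {A} {B} A∪B≡⊤ card = mk⇔
      (λ R≡ → Equivalence.from (⊕[h]⇔translate {A} {B})
                (autoconv≡⇒translate j odd-multiple {A} {B} A∪B≡⊤ (Sum.map₂ (∣∁∣≡2⊎4 {A ∩ B}) card) (autoconv≡ R≡)))
      (λ B≡A⊕[h] z → ℤ.+-injective (trans (R≡autoconv A z)
        (trans (translate⇒autoconv≡ {A} {B} (Equivalence.to (⊕[h]⇔translate {A} {B}) B≡A⊕[h]) z) (sym (R≡autoconv B z)))))
      where
      autoconv≡ : (∀ z → R A z ≡ R B z) → ∀ z → conv (χ A) (χ A) z ≡ conv (χ B) (χ B) z
      autoconv≡ R≡ z = trans (sym (R≡autoconv A z)) (trans (cong ℤ.+_ (R≡ z)) (R≡autoconv B z))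

theorem1p3 : (m : ℕ) .{{_ : NonZero m}} → 2 ∣ m → ¬ (4 ∣ m) →
    (A B : Subset m) → A ∪ B ≡ ⊤ → (∣ A ∩ B ∣ ≡ 4 ⊎ ∣ A ∩ B ∣ ≡ m ∸ 4) →
    ((∀ n → R A n ≡ R B n) ⇔ (B ≡ A ⊕ [ m / 2 ]ₘ))
theorem1p3 m 2∣m 4∤m A B A∪B≡⊤ card =
  let j , m≡h+h = twice-odd-of 2∣m 4∤m in
  subst (λ k → (∀ n → R A n ≡ R B n) ⇔ (B ≡ A ⊕ [ k ]ₘ)) (sym (half≡ m≡h+h))
        (ZModConvolution.TwiceOdd.R≡⇔⊕[h] m j m≡h+h A∪B≡⊤ card)
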